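{- For every connected split graph $G$ with $p$ pendant vertices and diameter $d$, $$\max\{p, d\} \leq rc(G) \leq \max\{p+1, 3\}.$$
   Context: All graphs are finite, simple and undirected. A rainbow path in an edge-coloured graph is a path no two of whose edges have the same colour. A rainbow colouring of a connected graph is an edge colouring in which every pair of vertices is joined by a rainbow path; $rc(G)$ is the minimum number of colours in a rainbow colouring of the connected graph $G$. A split graph is a graph whose vertex set can be partitioned into a clique and an independent set. A pendant vertex is a vertex of degree $1$. The diameter is the maximum distance between two vertices. -}

module Defs where

open import Data.Nat using (ℕ; zero; suc; _+_; _≤_; _⊔_)
open import Data.Nat.Properties using (_≟_)
open import Data.Bool using (Bool; true; false)
open import Data.Fin using (Fin)
open import Data.List using (List; []; _∷_; length; filter)
open import Data.List using (allFin)
open import Data.List.Relation.Unary.Unique.Propositional using (Unique)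
open import Data.Product using (Σ; _×_; ∃)
open import Relation.Binary.PropositionalEquality using (_≡_)
open import Relation.Nullary using (¬_)

record Graph (n : ℕ) : Set where
  field
    adj   : Fin n → Fin n → Bool
    sym   : ∀ u v → adj u v ≡ adj v u
    irref : ∀ v → adj v v ≡ false
open Graph public

module _ {n : ℕ} (G : Graph n) where

  data Walk : Fin n → Fin n → Set where
    []  : ∀ {u} → Walk u u
    _∷_ : ∀ {u w v} → adj G u w ≡ true → Walk w v → Walk u v

  len : ∀ {u v} → Walk u v → ℕ
  len []      = 0
  len (_ ∷ p) = suc (len p)

  verts : ∀ {u v} → Walk u v → List (Fin n)
  verts {u} []      = u ∷ []
  verts {u} (_ ∷ p) = u ∷ verts p

  IsPath : ∀ {u v} → Walk u v → Set
  IsPath p = Unique (verts p)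

  Connected : Set
  Connected = ∀ u v → Σ (Walk u v) IsPath

  Dist : Fin n → Fin n → ℕ → Set
  Dist u v m = Σ (Walk u v) (λ p → IsPath p × len p ≡ m)
             × (∀ (p : Walk u v) → IsPath p → m ≤ len p)

  Diameter : ℕ → Set
  Diameter d = (∀ u v m → Dist u v m → m ≤ d) × ∃ λ u → ∃ λ v → Dist u v d

  degree : Fin n → ℕ
  degree v = length (filter (λ u → adj G v u Data.Bool.≟ true) (allFin n))
    where import Data.Bool

  pendantCount : ℕ
  pendantCount = length (filter (λ v → degree v ≟ 1) (allFin n))

  -- split graph: vertex partition (true = clique side, false = independent side)
  IsSplit : Set
  IsSplit = Σ (Fin n → Bool) λ side →
              (∀ u v → side u ≡ true → side v ≡ true → ¬ u ≡ v → adj G u v ≡ true)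
            × (∀ u v → side u ≡ false → side v ≡ false → adj G u v ≡ false)

  record EdgeColouring (k : ℕ) : Set where
    field
      col    : Fin n → Fin n → Fin k
      colSym : ∀ u v → col u v ≡ col v u
  open EdgeColouring public

  colours : ∀ {k u v} → EdgeColouring k → Walk u v → List (Fin k)
  colours c []              = []
  colours {u = u} c (_∷_ {w = w} _ p) = col c u w ∷ colours c p

  IsRainbowColouring : ∀ {k} → EdgeColouring k → Set
  IsRainbowColouring c = ∀ u v → Σ (Walk u v) λ p → IsPath p × Unique (colours c p)

  HasRainbowColouring : ℕ → Set
  HasRainbowColouring k = Σ (EdgeColouring k) IsRainbowColouring

  RainbowConnectionNumber : ℕ → Set
  RainbowConnectionNumber r = HasRainbowColouring r × (∀ k → HasRainbowColouring k → r ≤ k)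

-- Lower bounds: a rainbow path has at least as many colours as edges, so rc ≥ d.
-- When n ≠ 2 no two pendant vertices are adjacent, so the rainbow path between two
-- of them starts and ends with their distinct pendant edges, whose colours must
-- therefore differ: rc ≥ p.
-- Upper bound: colour the clique edges 0, the edge at the i-th pendant vertex i + 1,
-- and at an independent vertex of degree ≥ 2 one edge 2 and the others 1. Any two
-- independent vertices u, v have neighbours a, b with ua, vb of distinct non-zero
-- colours, giving the rainbow path u a v or u a b v; every other non-adjacent pair
-- is joined through a single neighbour of its independent end.
module Submission where

open import Defs hiding (sym)
open import Data.Nat using (ℕ; suc; _+_; _≤_; _<_; _⊔_; z≤n; s≤s)
open import Data.Nat.Properties
  using (≤-trans; ≤-reflexive; ⊔-lub; m≤m⊔n; m≤n⊔m; +-comm; suc-injective; 0≢1+n)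
  renaming (_≟_ to _≟ℕ_)
open import Data.Bool using (Bool; true; false)
import Data.Bool as Bool
open import Data.Fin using (Fin; zero; suc; fromℕ<; punchIn; punchOut)
open import Data.Fin.Properties
  using (fromℕ<-cong; fromℕ<-injective; injective⇒≤; punchInᵢ≢i; punchIn-injective; punchIn-punchOut)
  renaming (_≟_ to _≟ᶠ_)
open import Data.List using (List; []; _∷_; length; filter; allFin; lookup; head)
open import Data.Maybe using (fromMaybe)
open import Data.List.Relation.Unary.All as All using (All; []; _∷_)
open import Data.List.Relation.Unary.AllPairs using ([]; _∷_)
open import Data.List.Relation.Unary.Any using (here; there)
open import Data.List.Relation.Unary.Unique.Propositional using (Unique)
import Data.List.Relation.Unary.Unique.Propositional.Properties as Unique
open import Data.List.Membership.Propositional using (_∈_)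
open import Data.List.Membership.Propositional.Properties using (∈-filter⁺; ∈-filter⁻; ∈-allFin; ∈-lookup)
open import Data.Product using (Σ; ∃; ∃₂; _×_; _,_; proj₂; uncurry)
open import Data.Sum using (_⊎_; inj₁; inj₂; [_,_]′)
open import Data.Empty using (⊥-elim)
open import Function using (_∘_; case_of_)
open import Function.Definitions using (Injective)
open import Relation.Binary.Definitions using (DecidableEquality)
open import Relation.Binary.PropositionalEquality
open import Relation.Nullary using (¬_; yes; no; contradiction)
open import Relation.Nullary.Decidable using (decidable-stable)

lookup-injective : ∀ {A : Set} {xs : List A} → Unique xs → Injective _≡_ _≡_ (lookup xs)
lookup-injective (_ ∷ _)    {zero}  {zero}  _  = refl
lookup-injective (x∉ ∷ _)   {zero}  {suc j} eq = contradiction eq (All.lookup x∉ (∈-lookup j))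
lookup-injective (x∉ ∷ _)   {suc i} {zero}  eq = contradiction (sym eq) (All.lookup x∉ (∈-lookup i))
lookup-injective (_ ∷ uniq) {suc i} {suc j} eq = cong suc (lookup-injective uniq eq)

Unique⇒length≤ : ∀ {r} {xs : List (Fin r)} → Unique xs → length xs ≤ r
Unique⇒length≤ uniq = injective⇒≤ (lookup-injective uniq)

third-element : ∀ {n} → n ≢ 2 → {a b : Fin n} → a ≢ b → ∃ λ t → t ≢ a × t ≢ b
third-element {1}             _   {zero} {zero} a≢b = contradiction refl a≢b
third-element {2}             n≢2 _                 = contradiction refl n≢2
third-element {suc (suc (suc _))} _ {a} {b} a≢b =
  punchIn a t , punchInᵢ≢i a t , t≢b
  where
  b′ = punchOut a≢b
  t  = punchIn b′ zero
  t≢b : punchIn a t ≢ b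
  t≢b eq = punchInᵢ≢i b′ zero (punchIn-injective a _ _ (trans eq (sym (punchIn-punchOut a≢b))))

module _ {A : Set} (_≟_ : DecidableEquality A) where

  position : A → List A → ℕ
  position x []       = 0
  position x (y ∷ ys) with x ≟ y
  ... | yes _ = 0
  ... | no  _ = suc (position x ys)

  position< : ∀ {x ys} → x ∈ ys → position x ys < length ys
  position< {x} {y ∷ ys} x∈ with x ≟ y
  ... | yes _ = s≤s z≤n
  position< (here x≡y) | no x≢y = contradiction x≡y x≢y
  position< (there x∈) | no _   = s≤s (position< x∈)

  position-injective : ∀ {x y zs} → x ∈ zs → y ∈ zs → position x zs ≡ position y zs → x ≡ y
  position-injective {x} {y} {z ∷ zs} x∈ y∈ eq with x ≟ z | y ≟ z
  ... | yes x≡z | yes y≡z = trans x≡z (sym y≡z)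
  ... | yes _   | no _    = contradiction eq 0≢1+n
  ... | no _    | yes _   = contradiction (sym eq) 0≢1+n
  position-injective (here x≡z) _           _  | no x≢z | no _   = contradiction x≡z x≢z
  position-injective (there _)  (here y≡z)  _  | no _   | no y≢z = contradiction y≡z y≢z
  position-injective (there x∈) (there y∈)  eq | no _   | no _   = position-injective x∈ y∈ (suc-injective eq)

module Neighbourhood {n} (G : Graph n) where

  adj-sym : ∀ {u v} → adj G u v ≡ true → adj G v u ≡ true
  adj-sym {u} {v} e = trans (Graph.sym G v u) e

  adj⇒≢ : ∀ {u v} → adj G u v ≡ true → u ≢ v
  adj⇒≢ {u} e refl with trans (sym e) (irref G u)
  ... | ()

  neighbours : Fin n → List (Fin n)
  neighbours x = filter (λ y → adj G x y Bool.≟ true) (allFin n)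

  adj⇒∈neighbours : ∀ {x y} → adj G x y ≡ true → y ∈ neighbours x
  adj⇒∈neighbours {x} = ∈-filter⁺ (λ y → adj G x y Bool.≟ true) (∈-allFin _)

  ∈neighbours⇒adj : ∀ {x y} → y ∈ neighbours x → adj G x y ≡ true
  ∈neighbours⇒adj {x} = proj₂ ∘ ∈-filter⁻ (λ y → adj G x y Bool.≟ true) {xs = allFin n}

  neighbours-unique : ∀ x → Unique (neighbours x)
  neighbours-unique x = Unique.filter⁺ (λ y → adj G x y Bool.≟ true) (Unique.allFin⁺ n)

  Pendant : Fin n → Set
  Pendant x = degree G x ≡ 1

  pendants : List (Fin n)
  pendants = filter (λ x → degree G x ≟ℕ 1) (allFin n)

  pendants-unique : Unique pendants
  pendants-unique = Unique.filter⁺ (λ x → degree G x ≟ℕ 1) (Unique.allFin⁺ n)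

  ∈pendants⇒Pendant : ∀ {x} → x ∈ pendants → Pendant x
  ∈pendants⇒Pendant = proj₂ ∘ ∈-filter⁻ (λ x → degree G x ≟ℕ 1) {xs = allFin n}

  singleton-neighbours⇒∈pendants : ∀ {x a} → neighbours x ≡ a ∷ [] → x ∈ pendants
  singleton-neighbours⇒∈pendants eq = ∈-filter⁺ (λ x → degree G x ≟ℕ 1) (∈-allFin _) (cong length eq)

  pendant-neighbour-unique : ∀ {z w w′} → Pendant z → adj G z w ≡ true → adj G z w′ ≡ true → w ≡ w′
  pendant-neighbour-unique {z} pz e e′ = go (neighbours z) pz (adj⇒∈neighbours e) (adj⇒∈neighbours e′)
    where
    go : ∀ ys → length ys ≡ 1 → ∀ {w w′} → w ∈ ys → w′ ∈ ys → w ≡ w′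
    go (_ ∷ []) _ (here w≡y) (here w′≡y) = trans w≡y (sym w′≡y)

  partner : Fin n → Fin n
  partner z = fromMaybe z (head (neighbours z))

  partner-adj : ∀ {z} → Pendant z → adj G z (partner z) ≡ true
  partner-adj {z} pz = ∈neighbours⇒adj (go (neighbours z) pz)
    where
    go : ∀ ys → length ys ≡ 1 → fromMaybe z (head ys) ∈ ys
    go (_ ∷ []) _ = here refl

  some-neighbour : Connected G → ∀ {u v} → u ≢ v → ∃ λ a → adj G u a ≡ true
  some-neighbour connected {u} {v} u≢v with connected u v
  ... | []           , _ = contradiction refl u≢v
  ... | _∷_ {w = a} e _ , _ = a , e

  first∈verts : ∀ {a b} (p : Walk G a b) → a ∈ verts G p
  first∈verts []      = here refl
  first∈verts (_ ∷ _) = here refl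

  adjacent-pendants-isolated : ∀ {z z′ t} → Pendant z → Pendant z′ → adj G z z′ ≡ true →
                               (p : Walk G z t) → IsPath G p → t ≡ z ⊎ t ≡ z′
  adjacent-pendants-isolated pz pz′ e []      _ = inj₁ refl
  adjacent-pendants-isolated pz pz′ e (e₁ ∷ []) _ = inj₂ (pendant-neighbour-unique pz e₁ e)
  adjacent-pendants-isolated {z′ = z′} pz pz′ e (_∷_ {w = w₁} e₁ (e₂ ∷ q)) (z∉ ∷ _) =
    contradiction (pendant-neighbour-unique pz′ (adj-sym e) (subst (λ w → adj G w _ ≡ true) w₁≡z′ e₂))
                  (All.lookup z∉ (there (first∈verts q)))
    where
    w₁≡z′ : w₁ ≡ z′
    w₁≡z′ = pendant-neighbour-unique pz e₁ e

  ¬adjacent-pendants : n ≢ 2 → Connected G → ∀ {z z′} → Pendant z → Pendant z′ → ¬ adj G z z′ ≡ true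
  ¬adjacent-pendants n≢2 connected {z} pz pz′ e with third-element n≢2 (adj⇒≢ e)
  ... | t , t≢z , t≢z′ =
    [ t≢z , t≢z′ ]′ (uncurry (adjacent-pendants-isolated pz pz′ e) (connected z t))

module RainbowPaths {n} (G : Graph n) {k} (c : EdgeColouring G k) where
  open Neighbourhood G

  RainbowPath : Fin n → Fin n → Set
  RainbowPath u v = Σ (Walk G u v) λ p → IsPath G p × Unique (colours G c p)

  rainbow-trivial : ∀ {u} → RainbowPath u u
  rainbow-trivial = [] , [] ∷ [] , []

  rainbow-edge : ∀ {u v} → adj G u v ≡ true → RainbowPath u v
  rainbow-edge e = e ∷ [] , (adj⇒≢ e ∷ []) ∷ [] ∷ [] , [] ∷ []

  rainbow-path₂ : ∀ {u w v} → adj G u w ≡ true → adj G w v ≡ true → u ≢ v →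
                  col c u w ≢ col c w v → RainbowPath u v
  rainbow-path₂ e₁ e₂ u≢v c₁≢c₂ =
    e₁ ∷ e₂ ∷ [] ,
    (adj⇒≢ e₁ ∷ u≢v ∷ []) ∷ (adj⇒≢ e₂ ∷ []) ∷ [] ∷ [] ,
    (c₁≢c₂ ∷ []) ∷ [] ∷ []

  rainbow-path₃ : ∀ {u a b v} → adj G u a ≡ true → adj G a b ≡ true → adj G b v ≡ true →
                  u ≢ b → a ≢ v → u ≢ v →
                  col c u a ≢ col c a b → col c u a ≢ col c b v → col c a b ≢ col c b v →
                  RainbowPath u v
  rainbow-path₃ e₁ e₂ e₃ u≢b a≢v u≢v c₁≢c₂ c₁≢c₃ c₂≢c₃ =
    e₁ ∷ e₂ ∷ e₃ ∷ [] ,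
    (adj⇒≢ e₁ ∷ u≢b ∷ u≢v ∷ []) ∷ (adj⇒≢ e₂ ∷ a≢v ∷ []) ∷ (adj⇒≢ e₃ ∷ []) ∷ [] ∷ [] ,
    (c₁≢c₂ ∷ c₁≢c₃ ∷ []) ∷ (c₂≢c₃ ∷ []) ∷ [] ∷ []

  rainbow⇒connected : IsRainbowColouring G c → Connected G
  rainbow⇒connected rainbow u v with rainbow u v
  ... | p , p-path , _ = p , p-path

  length-colours : ∀ {u v} (p : Walk G u v) → length (colours G c p) ≡ len G p
  length-colours []      = refl
  length-colours (_ ∷ p) = cong suc (length-colours p)

  rainbow-len≤ : ∀ {u v} (p : Walk G u v) → Unique (colours G c p) → len G p ≤ k
  rainbow-len≤ p uniq = ≤-trans (≤-reflexive (sym (length-colours p))) (Unique⇒length≤ uniq)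


module LowerBounds {n} (G : Graph n) where
  open Neighbourhood G

  diameter≤ : ∀ {d r} → Diameter G d → HasRainbowColouring G r → d ≤ r
  diameter≤ (_ , u , v , _ , shortest) (c , rainbow) with rainbow u v
  ... | p , p-path , p-rainbow = ≤-trans (shortest p p-path) (RainbowPaths.rainbow-len≤ G c p p-rainbow)

  module _ {k} (c : EdgeColouring G k) where

    pendantEdgeColour : Fin n → Fin k
    pendantEdgeColour z = col c z (partner z)

    pendantEdgeColour∈colours : ∀ {w z} → Pendant z → (q : Walk G w z) → w ≢ z →
                                pendantEdgeColour z ∈ colours G c q
    pendantEdgeColour∈colours pz []                 w≢z = contradiction refl w≢z
    pendantEdgeColour∈colours {w} {z} pz (_∷_ {w = w′} e q) w≢z with w′ ≟ᶠ z
    ... | no w′≢z = there (pendantEdgeColour∈colours pz q w′≢z)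
    ... | yes refl = here (begin
      col c z (partner z) ≡⟨ cong (col c z) (pendant-neighbour-unique pz (partner-adj pz) (adj-sym e)) ⟩
      col c z w           ≡⟨ colSym c z w ⟩
      col c w z           ∎)
      where open ≡-Reasoning

    pendantEdgeColours-distinct : n ≢ 2 → IsRainbowColouring G c → ∀ {z z′} → Pendant z → Pendant z′ →
                                  z ≢ z′ → pendantEdgeColour z ≢ pendantEdgeColour z′
    pendantEdgeColours-distinct n≢2 rainbow {z} {z′} pz pz′ z≢z′ with rainbow z z′
    ... | [] , _ = contradiction refl z≢z′
    ... | _∷_ {w = w} e q , _ , (first∉ ∷ _) with w ≟ᶠ z′
    ...   | yes refl = ⊥-elim (¬adjacent-pendants n≢2 (RainbowPaths.rainbow⇒connected G c rainbow) pz pz′ e)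
    ...   | no w≢z′ = λ eq → All.lookup first∉ (pendantEdgeColour∈colours pz′ q w≢z′)
                               (trans (cong (col c z) (pendant-neighbour-unique pz e (partner-adj pz))) eq)

  pendantCount≤ : n ≢ 2 → ∀ {r} → HasRainbowColouring G r → pendantCount G ≤ r
  pendantCount≤ n≢2 (c , rainbow) = injective⇒≤ colourOf-injective
    where
    colourOf : Fin (length pendants) → Fin _
    colourOf i = pendantEdgeColour c (lookup pendants i)
    colourOf-injective : Injective _≡_ _≡_ colourOf
    colourOf-injective {i} {j} eq = lookup-injective pendants-unique
      (decidable-stable (lookup pendants i ≟ᶠ lookup pendants j) λ zᵢ≢zⱼ →
        pendantEdgeColours-distinct c n≢2 rainbow
          (∈pendants⇒Pendant (∈-lookup i)) (∈pendants⇒Pendant (∈-lookup j)) zᵢ≢zⱼ eq)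

module SplitColouring {n} (G : Graph n) (side : Fin n → Bool)
  (clique : ∀ u v → side u ≡ true → side v ≡ true → ¬ u ≡ v → adj G u v ≡ true)
  (independent : ∀ u v → side u ≡ false → side v ≡ false → adj G u v ≡ false)
  where
  open Neighbourhood G

  k : ℕ
  k = (pendantCount G + 1) ⊔ 3

  pendantColour : Fin n → ℕ
  pendantColour x = suc (position _≟ᶠ_ x pendants)

  colourAt : Fin n → List (Fin n) → Fin n → ℕ
  colourAt x []          y = 0
  colourAt x (_ ∷ [])    y = pendantColour x
  colourAt x (_ ∷ b ∷ _) y with y ≟ᶠ b
  ... | yes _ = 2
  ... | no  _ = 1

  indepColour : Fin n → Fin n → ℕ
  indepColour x = colourAt x (neighbours x)

  colourBySide : Bool → Bool → Fin n → Fin n → ℕ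
  colourBySide false true  u v = indepColour u v
  colourBySide true  false u v = indepColour v u
  colourBySide _     _     u v = 0

  colourℕ : Fin n → Fin n → ℕ
  colourℕ u v = colourBySide (side u) (side v) u v

  colourℕ-sym : ∀ u v → colourℕ u v ≡ colourℕ v u
  colourℕ-sym u v with side u | side v
  ... | true  | true  = refl
  ... | true  | false = refl
  ... | false | true  = refl
  ... | false | false = refl

  colourℕ-clique : ∀ {u v} → side u ≡ true → side v ≡ true → colourℕ u v ≡ 0
  colourℕ-clique su sv rewrite su | sv = refl

  colourℕ-indep : ∀ {u v} → side u ≡ false → side v ≡ true → colourℕ u v ≡ indepColour u v
  colourℕ-indep su sv rewrite su | sv = refl

  small< : ∀ {m} → m ≤ 2 → m < k
  small< m≤2 = ≤-trans (s≤s m≤2) (m≤n⊔m (pendantCount G + 1) 3)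

  pendantColour< : ∀ {x} → x ∈ pendants → pendantColour x < k
  pendantColour< {x} x∈ = ≤-trans (s≤s (position< _≟ᶠ_ x∈))
    (≤-trans (≤-reflexive (+-comm 1 (pendantCount G))) (m≤m⊔n (pendantCount G + 1) 3))

  indepColour< : ∀ x y → indepColour x y < k
  indepColour< x y with neighbours x in eq
  ... | []        = small< z≤n
  ... | _ ∷ []    = pendantColour< (singleton-neighbours⇒∈pendants eq)
  ... | _ ∷ b ∷ _ with y ≟ᶠ b
  ...   | yes _ = small< (s≤s (s≤s z≤n))
  ...   | no  _ = small< (s≤s z≤n)

  colourℕ< : ∀ u v → colourℕ u v < k
  colourℕ< u v with side u | side v
  ... | true  | true  = small< z≤n
  ... | true  | false = indepColour< v u
  ... | false | true  = indepColour< u v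
  ... | false | false = small< z≤n

  C : EdgeColouring G k
  C = record
    { col    = λ u v → fromℕ< (colourℕ< u v)
    ; colSym = λ u v → fromℕ<-cong _ _ (colourℕ-sym u v) (colourℕ< u v) (colourℕ< v u)
    }

  neighbour-in-clique : ∀ {x a} → side x ≡ false → adj G x a ≡ true → side a ≡ true
  neighbour-in-clique {x} {a} sx e with side a in sa
  ... | true  = refl
  ... | false with trans (sym e) (independent x a sx sa)
  ...   | ()

  sides-differ : ∀ {x y} → side x ≡ false → side y ≡ true → x ≢ y
  sides-differ sx sy refl with trans (sym sx) sy
  ... | ()

  exit-colour : ∀ {u a} → side u ≡ false → adj G u a ≡ true → colourℕ u a ≡ indepColour u a
  exit-colour su e = colourℕ-indep su (neighbour-in-clique su e)

  entry-colour : ∀ {v b} → side v ≡ false → adj G v b ≡ true → colourℕ b v ≡ indepColour v b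
  entry-colour {v} {b} sv e = trans (colourℕ-sym b v) (exit-colour sv e)

  colourAt≢0 : ∀ x a r y → colourAt x (a ∷ r) y ≢ 0
  colourAt≢0 x a []      y ()
  colourAt≢0 x a (b ∷ r) y with y ≟ᶠ b
  ... | yes _ = λ ()
  ... | no  _ = λ ()

  indepColour≢0 : ∀ {x a} y → adj G x a ≡ true → indepColour x y ≢ 0
  indepColour≢0 {x} y e with neighbours x | adj⇒∈neighbours e
  ... | b ∷ r | _ = colourAt≢0 x b r y

  Exit : Fin n → ℕ → Set
  Exit x c = ∃ λ a → adj G x a ≡ true × indepColour x a ≡ c

  exit-pendant : ∀ {x a} → neighbours x ≡ a ∷ [] → Exit x (pendantColour x)
  exit-pendant {x} {a} eq =
    a , ∈neighbours⇒adj (subst (a ∈_) (sym eq) (here refl)) , cong (λ ys → colourAt x ys a) eq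

  exit-1 : ∀ {x a b r} → neighbours x ≡ a ∷ b ∷ r → Exit x 1
  exit-1 {x} {a} {b} {r} eq =
    a , ∈neighbours⇒adj (subst (a ∈_) (sym eq) (here refl)) ,
    trans (cong (λ ys → colourAt x ys a) eq) (first-colour a≢b)
    where
    a≢b : a ≢ b
    a≢b with subst Unique eq (neighbours-unique x)
    ... | (a≢b ∷ _) ∷ _ = a≢b
    first-colour : a ≢ b → colourAt x (a ∷ b ∷ r) a ≡ 1
    first-colour a≢b with a ≟ᶠ b
    ... | yes a≡b = contradiction a≡b a≢b
    ... | no  _   = refl

  exit-2 : ∀ {x a b r} → neighbours x ≡ a ∷ b ∷ r → Exit x 2
  exit-2 {x} {a} {b} {r} eq =
    b , ∈neighbours⇒adj (subst (b ∈_) (sym eq) (there (here refl))) ,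
    trans (cong (λ ys → colourAt x ys b) eq) second-colour
    where
    second-colour : colourAt x (a ∷ b ∷ r) b ≡ 2
    second-colour with b ≟ᶠ b
    ... | yes _   = refl
    ... | no  b≢b = contradiction refl b≢b

  DistinctExits : Fin n → Fin n → Set
  DistinctExits u v = ∃₂ λ c c′ → c ≢ c′ × Exit u c × Exit v c′

  pendant-branching-exits : ∀ {u v a a′ b′ r′} → neighbours u ≡ a ∷ [] → neighbours v ≡ a′ ∷ b′ ∷ r′ →
                            DistinctExits u v
  pendant-branching-exits {u} eu ev with pendantColour u ≟ℕ 1
  ... | yes c≡1 = _ , 2 , (λ c≡2 → contradiction (trans (sym c≡1) c≡2) (λ ())) , exit-pendant eu , exit-2 ev
  ... | no  c≢1 = _ , 1 , c≢1 , exit-pendant eu , exit-1 ev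

  data Shape (x : Fin n) : Set where
    pendant   : ∀ {a}     → neighbours x ≡ a ∷ []    → Shape x
    branching : ∀ {a b r} → neighbours x ≡ a ∷ b ∷ r → Shape x

  shape : ∀ {x a} → adj G x a ≡ true → Shape x
  shape {x} e with neighbours x in eq | adj⇒∈neighbours e
  ... | _ ∷ []    | _ = pendant eq
  ... | _ ∷ _ ∷ _ | _ = branching eq

  distinct-exits : ∀ {u v} → u ≢ v → Shape u → Shape v → DistinctExits u v
  distinct-exits u≢v (pendant eu) (pendant ev) =
    _ , _ , u≢v ∘ position-injective _≟ᶠ_ (singleton-neighbours⇒∈pendants eu)
                                          (singleton-neighbours⇒∈pendants ev) ∘ suc-injective ,
    exit-pendant eu , exit-pendant ev
  distinct-exits u≢v (pendant eu)   (branching ev) = pendant-branching-exits eu ev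
  distinct-exits u≢v (branching eu) (pendant ev) with pendant-branching-exits ev eu
  ... | c′ , c , c′≢c , exit-v , exit-u = c , c′ , ≢-sym c′≢c , exit-u , exit-v
  distinct-exits u≢v (branching eu) (branching ev) = 1 , 2 , (λ ()) , exit-1 eu , exit-2 ev

  open RainbowPaths G C

  colour≢ : ∀ {u v u′ v′ m m′} → colourℕ u v ≡ m → colourℕ u′ v′ ≡ m′ → m ≢ m′ → col C u v ≢ col C u′ v′
  colour≢ {u} {v} {u′} {v′} refl refl m≢m′ = m≢m′ ∘ fromℕ<-injective _ _ (colourℕ< u v) (colourℕ< u′ v′)

  indep-indep-path : ∀ {u v c c′} → side u ≡ false → side v ≡ false → u ≢ v →
                     c ≢ c′ → Exit u c → Exit v c′ → RainbowPath u v
  indep-indep-path {u} {v} su sv u≢v c≢c′ (a , ua , refl) (b , vb , refl) with a ≟ᶠ b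
  ... | yes refl = rainbow-path₂ ua (adj-sym vb) u≢v (colour≢ (exit-colour su ua) (entry-colour sv vb) c≢c′)
  ... | no  a≢b  = rainbow-path₃ ua (clique a b sa sb a≢b) (adj-sym vb)
                     (sides-differ su sb) (≢-sym (sides-differ sv sa)) u≢v
                     (colour≢ (exit-colour su ua) (colourℕ-clique sa sb) (indepColour≢0 a ua))
                     (colour≢ (exit-colour su ua) (entry-colour sv vb) c≢c′)
                     (colour≢ (colourℕ-clique sa sb) (entry-colour sv vb) (≢-sym (indepColour≢0 b vb)))
    where
    sa : side a ≡ true
    sa = neighbour-in-clique su ua
    sb : side b ≡ true
    sb = neighbour-in-clique sv vb

  indep-clique-path : ∀ {u v a} → side u ≡ false → side v ≡ true → adj G u v ≡ false →
                      adj G u a ≡ true → RainbowPath u v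
  indep-clique-path {u} {v} {a} su sv uv ua =
    rainbow-path₂ ua (clique a v sa sv a≢v) (sides-differ su sv)
      (colour≢ (exit-colour su ua) (colourℕ-clique sa sv) (indepColour≢0 a ua))
    where
    sa : side a ≡ true
    sa = neighbour-in-clique su ua
    a≢v : a ≢ v
    a≢v refl with trans (sym ua) uv
    ... | ()

  clique-indep-path : ∀ {u v b} → side u ≡ true → side v ≡ false → adj G u v ≡ false →
                      adj G v b ≡ true → RainbowPath u v
  clique-indep-path {u} {v} {b} su sv uv vb =
    rainbow-path₂ (clique u b su sb u≢b) (adj-sym vb) (≢-sym (sides-differ sv su))
      (colour≢ (colourℕ-clique su sb) (entry-colour sv vb) (≢-sym (indepColour≢0 b vb)))
    where
    sb : side b ≡ true
    sb = neighbour-in-clique sv vb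
    u≢b : u ≢ b
    u≢b refl with trans (sym (adj-sym vb)) uv
    ... | ()

  rainbow : Connected G → IsRainbowColouring G C
  rainbow connected u v with u ≟ᶠ v
  ... | yes refl = rainbow-trivial
  ... | no  u≢v with adj G u v in uv | side u in su | side v in sv
  ...   | true  | _     | _     = rainbow-edge uv
  ...   | false | true  | true  = case trans (sym (clique u v su sv u≢v)) uv of λ ()
  ...   | false | false | true  = indep-clique-path su sv uv (proj₂ (some-neighbour connected u≢v))
  ...   | false | true  | false = clique-indep-path su sv uv (proj₂ (some-neighbour connected (≢-sym u≢v)))
  ...   | false | false | false with some-neighbour connected u≢v | some-neighbour connected (≢-sym u≢v)
  ...     | _ , ua | _ , vb with distinct-exits u≢v (shape ua) (shape vb)
  ...       | _ , _ , c≢c′ , exit-u , exit-v = indep-indep-path su sv u≢v c≢c′ exit-u exit-v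

corollary2 : ∀ {n : ℕ} (G : Graph n) → ¬ n ≡ 2 → Connected G → IsSplit G →
    ∀ (d r : ℕ) → Diameter G d → RainbowConnectionNumber G r →
    ((pendantCount G ⊔ d) ≤ r) × (r ≤ ((pendantCount G + 1) ⊔ 3))
corollary2 G n≢2 connected (side , clique , independent) d r diameter (rainbow-r , minimal) =
  ⊔-lub (pendantCount≤ n≢2 rainbow-r) (diameter≤ diameter rainbow-r) ,
  minimal k (C , rainbow connected)
  where
  open LowerBounds G
  open SplitColouring G side clique independent
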